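{- Let $A$ be a nonempty finite set and let $(\mathcal P,\mathcal S)$ be a scenario on $A$. If $\mathcal P$ has a bramble avoiding $\mathcal S$, then the robber has a winning strategy in the captain and robber game on $(\mathcal P,\mathcal S)$.
   Context: A partition of $A$ is a set $P$ of pairwise disjoint subsets of $A$ (empty sets allowed) whose union is $A$; $\textup{Part}(A)$ is the set of all partitions. $P_1$ is coarser than $P_2$ if each set of $P_1$ is a union of sets of $P_2$; $P_1\vee P_2$ is the finest common coarsening. $X^c=A\setminus X$. A scenario on $A$ is a pair $(\mathcal P,\mathcal S)$, $\mathcal P\subseteq\textup{Part}(A)$, $\mathcal S\subseteq 2^A$, with: (SC1) $\mathcal P$ closed under coarser partitions; (SC2) if $X\subseteq S\in\mathcal S$ and $X\in P$ for some $P\in\mathcal P$ then $X\in\mathcal S$; (SC3) $\{S,S^c\}\in\mathcal P$ for every $S\in\mathcal S$. Captain and robber game on $(\mathcal P,\mathcal S)$: initially the captain chooses $\{A\}$ and the robber an element of $A$; if $\{A\}\notin\mathcal P$ the robber wins. In position $(P,r)$ with $r\in X\in P$, the captain announces $P'\in\mathcal P$, the robber moves to any element $r'$ of the set of $P\vee P'$ containing $X$, and the new robber space is the set $X'\in P'$ containing $r'$; if $X'\in\mathcal S$ the captain wins, otherwise play continues. The robber wins if never captured. A bramble for $\mathcal P$ is a nonempty collection $\mathcal B$ of nonempty, pairwise intersecting subsets of $A$ such that every $P\in\mathcal P$ satisfies $P\cap\mathcal B\neq\emptyset$. It avoids $\mathcal S$ if $\mathcal B\cap\mathcal S=\emptyset$.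 -}

module Defs where

open import Data.Nat using (ℕ; zero; suc)
open import Data.Fin using (Fin)
open import Data.Fin.Subset using (Subset; _∈_; _⊆_; ∁; ⊤)
open import Data.Product using (Σ; ∃; _×_; _,_; proj₁)
open import Data.Sum using (_⊎_)
open import Data.List using (List; applyUpTo)
open import Data.Empty using (⊥)
open import Relation.Nullary using (¬_)
open import Relation.Binary.PropositionalEquality using (_≡_; _≢_)

-- The ground set A is Fin n.  Subsets of A are 'Subset n'.
-- A family (set) of subsets of A is a predicate on subsets.
Family : ℕ → Set₁
Family n = Subset n → Set

module _ {n : ℕ} where

  -- P is a partition of A: pairwise disjoint members whose union is A
  -- (empty members allowed).
  IsPartition : Family n → Set
  IsPartition P =
    (∀ X Y → P X → P Y → X ≢ Y → ∀ a → a ∈ X → a ∈ Y → ⊥)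
    × (∀ a → ∃ λ X → P X × a ∈ X)

  -- P₁ is coarser than P₂: every set of P₁ is a union of sets of P₂,
  -- i.e. every point of Y ∈ P₁ lies in some X ∈ P₂ with X ⊆ Y.
  Coarser : Family n → Family n → Set
  Coarser P₁ P₂ = ∀ Y → P₁ Y → ∀ a → a ∈ Y → ∃ λ X → P₂ X × a ∈ X × X ⊆ Y

  IsJoin : Family n → Family n → Family n → Set₁
  IsJoin P₁ P₂ Q =
    IsPartition Q × Coarser Q P₁ × Coarser Q P₂
    × (∀ (R : Family n) → IsPartition R → Coarser R P₁ → Coarser R P₂ → Coarser R Q)

  Whole : Family n
  Whole X = X ≡ ⊤

  Pair : Subset n → Family n
  Pair S X = (X ≡ S) ⊎ (X ≡ ∁ S)

  record IsScenario (𝒫 : Family n → Set) (𝒮 : Family n) : Set₁ where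
    field
      parts : ∀ P → 𝒫 P → IsPartition P
      SC1   : ∀ P Q → 𝒫 P → IsPartition Q → Coarser Q P → 𝒫 Q
      SC2   : ∀ X S → 𝒮 S → X ⊆ S → (∃ λ P → 𝒫 P × P X) → 𝒮 X
      SC3   : ∀ S → 𝒮 S → 𝒫 (Pair S)

  record IsBramble (𝒫 : Family n → Set) (ℬ : Family n) : Set₁ where
    field
      nonempty     : ∃ λ B → ℬ B
      members-ne   : ∀ B → ℬ B → ∃ λ a → a ∈ B
      intersecting : ∀ B C → ℬ B → ℬ C → ∃ λ a → a ∈ B × a ∈ C
      hits         : ∀ P → 𝒫 P → ∃ λ X → P X × ℬ X

  Avoids : Family n → Family n → Set
  Avoids ℬ 𝒮 = ∀ X → ℬ X → ¬ 𝒮 X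

  module Game (𝒫 : Family n → Set) (𝒮 : Family n) where

    Move : Set₁
    Move = Σ (Family n) 𝒫

    -- A (history-dependent) robber strategy: an initial element, and a
    -- response to the current captain move given all previous captain moves
    -- (the robber's own earlier moves are determined by these).
    record RobberStrategy : Set₁ where
      field
        start   : Fin n
        respond : List Move → Move → Fin n

    module Play (σ : RobberStrategy) (c : ℕ → Move) where
      open RobberStrategy σ

      partAt : ℕ → Family n
      partAt zero    = Whole
      partAt (suc k) = proj₁ (c k)

      robAt : ℕ → Fin n
      robAt zero    = start
      robAt (suc k) = respond (applyUpTo c k) (c k)

      Legal : ℕ → Set₁
      Legal k = ∃ λ (Q : Family n) → IsJoin (partAt k) (proj₁ (c k)) Q ×
                (∃ λ X → partAt k X × robAt k ∈ X ×
                  (∃ λ Y → Q Y × X ⊆ Y × robAt (suc k) ∈ Y))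

      NotCaptured : ℕ → Set
      NotCaptured k = ∀ X' → proj₁ (c k) X' → robAt (suc k) ∈ X' → ¬ 𝒮 X'

    Winning : RobberStrategy → Set₁
    Winning σ = ∀ (c : ℕ → Move) (k : ℕ) → Play.Legal σ c k × Play.NotCaptured σ c k

    RobberWins : Set₁
    RobberWins = ¬ 𝒫 Whole ⊎ Σ RobberStrategy Winning

-- Every captain move P' ∈ 𝒫 meets the bramble ℬ; the robber
-- fixes a chosen member B(P') ∈ P' ∩ ℬ.  On the first move he goes to any
-- point of B(P'₁); afterwards, on move P'ₖ₊₁, he goes to a point of
-- B(P'ₖ) ∩ B(P'ₖ₊₁), which is nonempty because bramble members intersect.
-- Thus his robber space is always B(P'ₖ) ∉ 𝒮, so he is never captured, and
-- every move is legal: he stays inside his current space B(P'ₖ), which lies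
-- inside one block of the join of the two partitions.
--
-- The only real work is the existence of joins P₁ ∨ P₂ of partitions of
-- Fin n, which the statement of legality requires.  Their blocks are the
-- connected components of "same block in P₁ or in P₂", built as least
-- closed supersets by well-founded recursion on ⊃.
module Submission where

open import Defs
open import Data.Nat using (ℕ; _<_)
open import Data.Product using (Σ; _×_)

open import Data.Nat using (suc)
open import Data.Fin using (Fin)
import Data.Fin.Properties as Finₚ
open import Data.Fin.Subset using (Subset; _∈_; _⊆_; _⊂_; _⊃_; _∪_; ∁; ⊤; ⁅_⁆)
open import Data.Fin.Subset.Properties
  using (_∈?_; _⊂?_; ⊆-antisym; p⊆p∪q; x∈p∪q⁻; x∈p∪q⁺; x∉p⇒x∈∁p; x∈∁p⇒x∉p; ∈⊤; x∈⁅x⁆; x∈⁅y⁆⇒x≡y)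
open import Data.Fin.Subset.Induction using (Acc; acc; ⊃-wellFounded)
open import Data.Product using (∃; _,_; proj₁; proj₂)
open import Data.Sum using (_⊎_; inj₁; inj₂)
open import Data.Empty using (⊥-elim)
open import Data.Bool using (true)
import Data.Bool.Properties as Boolₚ
open import Data.Vec using (tabulate)
import Data.Vec.Properties as Vecₚ
open import Data.List using (List; []; _∷_; _∷ʳ_; last; applyUpTo)
open import Data.List.Properties using (applyUpTo-∷ʳ)
open import Data.Maybe using (Maybe; just; nothing)
open import Function using (_∘_)
open import Relation.Nullary using (¬_; Dec; yes; no; does)
open import Relation.Nullary.Decidable using (dec-true; decidable-stable; _×-dec_; _⊎-dec_)
open import Relation.Binary.PropositionalEquality using (_≡_; refl; sym; trans; cong; subst)

-- Decidable equality of subsets; needed to extract equalities of blocks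
-- from the negative disjointness condition of IsPartition.
_≟ˢ_ : ∀ {n} (X Y : Subset n) → Dec (X ≡ Y)
_≟ˢ_ = Vecₚ.≡-dec Boolₚ._≟_

module Comprehension {n : ℕ} {P : Fin n → Set} (P? : ∀ x → Dec (P x)) where

  ⟦P⟧ : Subset n
  ⟦P⟧ = tabulate (does ∘ P?)

  ∈⟦P⟧⁺ : ∀ {x} → P x → x ∈ ⟦P⟧
  ∈⟦P⟧⁺ {x} px = Vecₚ.lookup⇒[]= x ⟦P⟧ (trans (Vecₚ.lookup∘tabulate _ x) (dec-true (P? x) px))

  ∈⟦P⟧⁻ : ∀ {x} → x ∈ ⟦P⟧ → P x
  ∈⟦P⟧⁻ {x} m = does-true (P? x) (trans (sym (Vecₚ.lookup∘tabulate _ x)) (Vecₚ.[]=⇒lookup m))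
    where
    does-true : ∀ {A : Set} (d : Dec A) → does d ≡ true → A
    does-true (yes a) _ = a
    does-true (no _) ()

⊆∧¬⊂⇒⊇ : ∀ {n} {S T : Subset n} → S ⊆ T → ¬ S ⊂ T → T ⊆ S
⊆∧¬⊂⇒⊇ {S = S} S⊆T S⊄T {x} x∈T =
  decidable-stable (x ∈? S) (λ x∉S → S⊄T (S⊆T , x , x∈T , x∉S))

module Components {n : ℕ} (R : Fin n → Fin n → Set)
  (R? : ∀ b c → Dec (R b c)) (R-sym : ∀ {b c} → R b c → R c b) where

  Closed : Subset n → Set
  Closed Z = ∀ {b c} → b ∈ Z → R b c → c ∈ Z

  module Neighbours (S : Subset n) =
    Comprehension {P = λ c → ∃ λ b → b ∈ S × R b c} (λ c → Finₚ.any? (λ b → (b ∈? S) ×-dec R? b c))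

  step : Subset n → Subset n
  step S = S ∪ Neighbours.⟦P⟧ S

  step-⊇ : ∀ S → S ⊆ step S
  step-⊇ S = p⊆p∪q _

  step-neighbour : ∀ S {b c} → b ∈ S → R b c → c ∈ step S
  step-neighbour S b∈S r = x∈p∪q⁺ (inj₂ (Neighbours.∈⟦P⟧⁺ S (_ , b∈S , r)))

  step-least : ∀ S Z → Closed Z → S ⊆ Z → step S ⊆ Z
  step-least S Z cl S⊆Z m with x∈p∪q⁻ S _ m
  ... | inj₁ c∈S = S⊆Z c∈S
  ... | inj₂ c∈N with Neighbours.∈⟦P⟧⁻ S c∈N
  ...   | b , b∈S , r = cl (S⊆Z b∈S) r

  record Closure (S : Subset n) : Set where
    field
      carrier : Subset n
      base    : S ⊆ carrier
      closed  : Closed carrier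
      least   : ∀ Z → Closed Z → S ⊆ Z → carrier ⊆ Z

  closure : ∀ S → Acc _⊃_ S → Closure S
  closure S (acc rec) with S ⊂? step S
  ... | yes S⊂stepS =
    record { carrier = carrier ; base = base ∘ step-⊇ S ; closed = closed
           ; least = λ Z cl S⊆Z → least Z cl (step-least S Z cl S⊆Z) }
    where open Closure (closure (step S) (rec S⊂stepS))
  ... | no S⊄stepS =
    record { carrier = S ; base = λ m → m
           ; closed = λ b∈S r → ⊆∧¬⊂⇒⊇ (step-⊇ S) S⊄stepS (step-neighbour S b∈S r)
           ; least = λ _ _ S⊆Z → S⊆Z }

  comp : Fin n → Subset n
  comp a = Closure.carrier (closure ⁅ a ⁆ (⊃-wellFounded ⁅ a ⁆))

  comp-self : ∀ a → a ∈ comp a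
  comp-self a = Closure.base (closure ⁅ a ⁆ _) (x∈⁅x⁆ a)

  comp-closed : ∀ a → Closed (comp a)
  comp-closed a = Closure.closed (closure ⁅ a ⁆ _)

  comp-least : ∀ Z a → Closed Z → a ∈ Z → comp a ⊆ Z
  comp-least Z a cl a∈Z = Closure.least (closure ⁅ a ⁆ _) Z cl
    (λ m → subst (_∈ Z) (sym (x∈⁅y⁆⇒x≡y a m)) a∈Z)

  -- by symmetry of R, complements of closed sets are closed
  ∁-closed : ∀ Z → Closed Z → Closed (∁ Z)
  ∁-closed Z cl b∈∁Z r = x∉p⇒x∈∁p (λ c∈Z → x∈∁p⇒x∉p b∈∁Z (cl c∈Z (R-sym r)))

  comp-sym : ∀ a c → c ∈ comp a → a ∈ comp c
  comp-sym a c c∈a = decidable-stable (a ∈? comp c) λ a∉c →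
    x∈∁p⇒x∉p (comp-least (∁ (comp c)) a (∁-closed _ (comp-closed c)) (x∉p⇒x∈∁p a∉c) c∈a)
             (comp-self c)

  comp-eq : ∀ a c → c ∈ comp a → comp a ≡ comp c
  comp-eq a c c∈a = ⊆-antisym (comp-least _ a (comp-closed c) (comp-sym a c c∈a))
                              (comp-least _ c (comp-closed a) c∈a)

module _ {n : ℕ} where

  module Blocks {P : Family n} (isP : IsPartition P) where

    block : Fin n → Subset n
    block a = proj₁ (proj₂ isP a)

    block-∈ : ∀ a → P (block a)
    block-∈ a = proj₁ (proj₂ (proj₂ isP a))

    ∈-block : ∀ a → a ∈ block a
    ∈-block a = proj₂ (proj₂ (proj₂ isP a))

    block-unique : ∀ {Y a} → P Y → a ∈ Y → Y ≡ block a
    block-unique {Y} {a} PY a∈Y with Y ≟ˢ block a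
    ... | yes eq = eq
    ... | no neq = ⊥-elim (proj₁ isP Y _ PY (block-∈ a) neq a a∈Y (∈-block a))

    same-block : ∀ {X Y a} → P X → P Y → a ∈ X → a ∈ Y → X ≡ Y
    same-block PX PY a∈X a∈Y = trans (block-unique PX a∈X) (sym (block-unique PY a∈Y))

  whole-partition : IsPartition {n} Whole
  whole-partition = (λ { _ _ refl refl X≢Y _ _ _ → X≢Y refl })
                  , (λ a → ⊤ , refl , ∈⊤)

  coarser-contains : ∀ {P Q : Family n} → IsPartition P → IsPartition Q → Coarser Q P →
                     ∀ {X p} → P X → p ∈ X → ∃ λ Y → Q Y × X ⊆ Y × p ∈ Y
  coarser-contains isP isQ Q≽P {X} {p} PX p∈X = Q.block p , Q.block-∈ p , X⊆block , Q.∈-block p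
    where
    module P = Blocks isP
    module Q = Blocks isQ
    -- Q.block p is a union of P-blocks, and the one through p is X
    X⊆block : X ⊆ Q.block p
    X⊆block with Q≽P _ (Q.block-∈ p) p (Q.∈-block p)
    ... | X' , PX' , p∈X' , X'⊆Y = subst (_⊆ Q.block p) (P.same-block PX' PX p∈X' p∈X) X'⊆Y

  join-exists : ∀ {P₁ P₂ : Family n} → IsPartition P₁ → IsPartition P₂ →
                ∃ λ (Q : Family n) → IsJoin P₁ P₂ Q
  join-exists {P₁} {P₂} isP₁ isP₂ = Q , (isQ , Q≽P₁ , Q≽P₂ , finest)
    where
    module B₁ = Blocks isP₁
    module B₂ = Blocks isP₂

    Linked : Fin n → Fin n → Set
    Linked b c = c ∈ B₁.block b ⊎ c ∈ B₂.block b

    linked-sym : ∀ {b c} → Linked b c → Linked c b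
    linked-sym {b} {c} (inj₁ m) = inj₁ (subst (b ∈_) (B₁.block-unique (B₁.block-∈ b) m) (B₁.∈-block b))
    linked-sym {b} {c} (inj₂ m) = inj₂ (subst (b ∈_) (B₂.block-unique (B₂.block-∈ b) m) (B₂.∈-block b))

    open Components Linked (λ b c → (c ∈? B₁.block b) ⊎-dec (c ∈? B₂.block b)) linked-sym

    Q : Family n
    Q Y = ∃ λ a → Y ≡ comp a

    isQ : IsPartition Q
    isQ = (λ { _ _ (a , refl) (b , refl) X≢Y x x∈X x∈Y →
               X≢Y (trans (comp-eq a x x∈X) (sym (comp-eq b x x∈Y))) })
        , (λ a → comp a , (a , refl) , comp-self a)

    Q≽P₁ : Coarser Q P₁
    Q≽P₁ _ (b , refl) a a∈Y = B₁.block a , B₁.block-∈ a , B₁.∈-block a , comp-closed b a∈Y ∘ inj₁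

    Q≽P₂ : Coarser Q P₂
    Q≽P₂ _ (b , refl) a a∈Y = B₂.block a , B₂.block-∈ a , B₂.∈-block a , comp-closed b a∈Y ∘ inj₂

    -- a block of a common coarsening is closed under Linked, so it
    -- contains the component of each of its points
    finest : ∀ R → IsPartition R → Coarser R P₁ → Coarser R P₂ → Coarser R Q
    finest R _ R≽P₁ R≽P₂ Z RZ a a∈Z = comp a , (a , refl) , comp-self a , comp-least Z a closed a∈Z
      where
      closed : Closed Z
      closed {b} {c} b∈Z (inj₁ m) with R≽P₁ Z RZ b b∈Z
      ... | W , PW , b∈W , W⊆Z = W⊆Z (subst (c ∈_) (sym (B₁.block-unique PW b∈W)) m)
      closed {b} {c} b∈Z (inj₂ m) with R≽P₂ Z RZ b b∈Z
      ... | W , PW , b∈W , W⊆Z = W⊆Z (subst (c ∈_) (sym (B₂.block-unique PW b∈W)) m)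

-- The robber's history list ends with the captain's previous move.
last-applyUpTo : ∀ {a} {A : Set a} (c : ℕ → A) k → last (applyUpTo c (suc k)) ≡ just (c k)
last-applyUpTo c k = trans (cong last (sym (applyUpTo-∷ʳ c k))) (last-∷ʳ (applyUpTo c k))
  where
  last-∷ʳ : ∀ {a} {A : Set a} {x : A} (xs : List A) → last (xs ∷ʳ x) ≡ just x
  last-∷ʳ []           = refl
  last-∷ʳ (_ ∷ [])     = refl
  last-∷ʳ (_ ∷ _ ∷ xs) = last-∷ʳ (_ ∷ xs)

module BrambleStrategy {n : ℕ} (𝒫 : Family n → Set) (𝒮 : Family n)
  (parts : ∀ P → 𝒫 P → IsPartition P)
  {ℬ : Family n} (isℬ : IsBramble 𝒫 ℬ) (ℬ-avoids : Avoids ℬ 𝒮) (a₀ : Fin n) where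

  open IsBramble isℬ
  open Game 𝒫 𝒮

  chosen : Move → Subset n
  chosen m = proj₁ (hits (proj₁ m) (proj₂ m))

  chosen-∈ : ∀ m → proj₁ m (chosen m)
  chosen-∈ m = proj₁ (proj₂ (hits (proj₁ m) (proj₂ m)))

  chosen-ℬ : ∀ m → ℬ (chosen m)
  chosen-ℬ m = proj₂ (proj₂ (hits (proj₁ m) (proj₂ m)))

  target : Maybe Move → Move → Fin n
  target nothing   m = proj₁ (members-ne (chosen m) (chosen-ℬ m))
  target (just m') m = proj₁ (intersecting (chosen m') (chosen m) (chosen-ℬ m') (chosen-ℬ m))

  σ : RobberStrategy
  σ = record { start = a₀ ; respond = λ history m → target (last history) m }

  module Analysis (c : ℕ → Move) where
    open Play σ c

    spaceAt : ℕ → Subset n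
    spaceAt 0       = ⊤
    spaceAt (suc k) = chosen (c k)

    partAt-partition : ∀ k → IsPartition (partAt k)
    partAt-partition 0       = whole-partition
    partAt-partition (suc k) = parts _ (proj₂ (c k))

    spaceAt-∈ : ∀ k → partAt k (spaceAt k)
    spaceAt-∈ 0       = refl
    spaceAt-∈ (suc k) = chosen-∈ (c k)

    moves-within : ∀ k → robAt (suc k) ∈ spaceAt k × robAt (suc k) ∈ chosen (c k)
    moves-within 0 = ∈⊤ , proj₂ (members-ne _ (chosen-ℬ (c 0)))
    moves-within (suc k) rewrite last-applyUpTo c k =
      proj₂ (intersecting (chosen (c k)) (chosen (c (suc k))) (chosen-ℬ (c k)) (chosen-ℬ (c (suc k))))

    in-space : ∀ k → robAt k ∈ spaceAt k
    in-space 0       = ∈⊤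
    in-space (suc k) = proj₂ (moves-within k)

    -- the robber stays in his space X, which lies in one block of the join
    legal : ∀ k → Legal k
    legal k with join-exists (partAt-partition k) (parts _ (proj₂ (c k)))
    ... | Q , isJ@(isQ , Q≽old , _) =
      Q , isJ , spaceAt k , spaceAt-∈ k , in-space k ,
      coarser-contains (partAt-partition k) isQ Q≽old (spaceAt-∈ k) (proj₁ (moves-within k))

    not-captured : ∀ k → NotCaptured k
    not-captured k X' X'∈ r∈X' 𝒮X' =
      ℬ-avoids _ (chosen-ℬ (c k)) (subst 𝒮 (same-block X'∈ (chosen-∈ (c k)) r∈X' (proj₂ (moves-within k))) 𝒮X')
      where open Blocks (parts _ (proj₂ (c k)))

  σ-wins : Winning σ
  σ-wins c k = legal k , not-captured k
    where open Analysis c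

lemma1 : (n : ℕ) → 0 < n → (𝒫 : Family n → Set) (𝒮 : Family n) →
         IsScenario 𝒫 𝒮 →
         Σ (Family n) (λ ℬ → IsBramble 𝒫 ℬ × Avoids ℬ 𝒮) →
         Game.RobberWins 𝒫 𝒮
lemma1 (suc n) _ 𝒫 𝒮 scenario (ℬ , isℬ , ℬ-avoids) = inj₂ (σ , σ-wins)
  where open BrambleStrategy 𝒫 𝒮 (IsScenario.parts scenario) isℬ ℬ-avoids Fin.zero
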